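{- For all integers $n\ge 2$, $$R_{2n}(3) \ge (R_n(3)-1)^2 + m\,(R_{n-1}(3)-1)+1, \qquad\text{where } m=\left\lceil \frac{R_n(3)-2}{n}\right\rceil .$$
   Context: For integers $n\ge1$ and $k\ge1$, $R_n(k)$ denotes the least $s>0$ such that every assignment of one of $n$ colors to each edge of the complete graph $K_s$ contains a complete subgraph $K_k$ all of whose edges have the same color (a monochromatic $K_k$). In particular $R_1(3)=3$. -}

module Defs where

open import Data.Nat using (ℕ; zero; suc; _+_; _∸_; _≤_; _<_; NonZero)
open import Data.Nat.DivMod using (_/_)
open import Data.Fin using (Fin) renaming (_<_ to _<ᶠ_)
open import Data.Product using (Σ; _×_)
open import Relation.Binary.PropositionalEquality using (_≡_)

-- An n-colouring of the edges of K_s: the colour of the edge {x,y} with x < y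
-- is c x y (values c x y with x ≥ y are irrelevant, never inspected).
EdgeColouring : ℕ → ℕ → Set
EdgeColouring n s = Fin s → Fin s → Fin n

HasMonoClique : ∀ {n s} → EdgeColouring n s → ℕ → Set
HasMonoClique {n} {s} c k =
  Σ (Fin n) λ col → Σ (Fin k → Fin s) λ f →
    (∀ i j → i <ᶠ j → f i <ᶠ f j) × (∀ i j → i <ᶠ j → c (f i) (f j) ≡ col)

Arrows : ℕ → ℕ → ℕ → Set
Arrows n s k = (c : EdgeColouring n s) → HasMonoClique c k

IsRamsey : ℕ → ℕ → ℕ → Set
IsRamsey n k r = (0 < r) × Arrows n r k × (∀ s → 0 < s → Arrows n s k → r ≤ s)

ceilDiv : ℕ → (b : ℕ) → .{{_ : NonZero b}} → ℕ
ceilDiv a b = (a + (b ∸ 1)) / b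

module Submission where

-- Let c₁ be an n-colouring of K_a (a = R_n(3) - 1) and c₂ an (n-1)-colouring of
-- K_b (b = R_{n-1}(3) - 1), both without monochromatic triangles.  By the
-- pigeonhole principle some colour i joins vertex 0 of c₁ to a set T of
-- m = ⌈(a-1)/n⌉ vertices, and T contains no edge of colour i.  Using two copies
-- of the n colours we colour a² + m·b vertices: the product Fin a × Fin a is
-- coloured lexicographically (first coordinates in palette 1, second coordinates
-- in palette 2), except that i-coloured edges between rows of T move to palette 2;
-- m blocks, each a copy of c₂ on the palette-1 colours other than i, are attached
-- to the vertices of T and joined in colour i to the product vertices whose row
-- lies in T.  A case analysis shows this colouring is triangle-free.  (The
-- argument only needs n ≥ 1.)

open import Defs
open import Data.Nat using (ℕ; zero; suc; _+_; _*_; _∸_; _≤_; _<_; z≤n; s≤s; s≤s⁻¹; NonZero)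
import Data.Nat.Properties as ℕP
open import Data.Nat.DivMod using (m<n*o⇒m/o<n)
open import Data.Fin using (Fin; zero; suc; _≟_; lift; inject≤; punchIn) renaming (_<_ to _<ᶠ_)
open import Data.Fin.Patterns using (0F; 1F; 2F)
import Data.Fin.Properties as FinP
open import Data.Empty using (⊥)
open import Data.Product using (Σ; ∃; _×_; _,_; proj₁; proj₂)
open import Data.Sum using (_⊎_; inj₁; inj₂)
open import Data.Sum.Function.Propositional using (_⊎-↔_)
open import Function.Base using (_∘_)
open import Function.Bundles using (_↣_; Injection)
open import Function.Definitions using (Injective)
open import Function.Properties.Inverse using (↔-sym; ↔-trans; ↔⇒↣)
open import Relation.Nullary using (¬_; Dec; yes; no; contradiction)
open import Relation.Nullary.Decidable using (_×-dec_; _⊎-dec_; ¬?; map′; decidable-stable)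
open import Relation.Binary using (Tri; tri<; tri≈; tri>)
open import Relation.Binary.PropositionalEquality using (_≡_; _≢_; refl; sym; trans; cong; cong₂; subst)
open import Algebra.Properties.CommutativeMonoid.Sum ℕP.+-0-commutativeMonoid
  using (sum; ∑-distrib-+; sum-remove)

indicator : ∀ {A : Set} → Dec A → ℕ
indicator (yes _) = 1
indicator (no _)  = 0

indicator-refl : ∀ {A : Set} {x : A} (d : Dec (x ≡ x)) → 1 ≤ indicator d
indicator-refl (yes _)  = s≤s z≤n
indicator-refl (no x≢x) = contradiction refl x≢x

term≤sum : ∀ {n} (f : Fin n → ℕ) (i : Fin n) → f i ≤ sum f
term≤sum {suc _} f i = subst (f i ≤_) (sym (sum-remove {i = i} f)) (ℕP.m≤m+n (f i) _)

sum<-bound : ∀ {n M} (f : Fin n → ℕ) → (∀ i → f i < M) → n + sum f ≤ n * M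
sum<-bound {zero}  f f<M = z≤n
sum<-bound {suc n} {M} f f<M = begin
  suc n + (f zero + rest)  ≡⟨ cong suc (ℕP.+-comm n _) ⟩
  suc (f zero + rest + n)  ≡⟨ cong suc (ℕP.+-assoc (f zero) rest n) ⟩
  suc (f zero) + (rest + n) ≡⟨ cong (suc (f zero) +_) (ℕP.+-comm rest n) ⟩
  suc (f zero) + (n + rest) ≤⟨ ℕP.+-mono-≤ (f<M zero) (sum<-bound (f ∘ suc) (f<M ∘ suc)) ⟩
  M + n * M                ∎
  where
  open ℕP.≤-Reasoning
  rest : ℕ
  rest = sum (f ∘ suc)

fibreSize : ∀ {a N} → (Fin a → Fin N) → Fin N → ℕ
fibreSize g i = sum (λ y → indicator (g y ≟ i))

fibres-cover : ∀ {N} a (g : Fin a → Fin N) → a ≤ sum (fibreSize g)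
fibres-cover zero g = z≤n
fibres-cover (suc a) g = begin
  1 + a                                  ≤⟨ ℕP.+-mono-≤ first-point (fibres-cover a (g ∘ suc)) ⟩
  sum first + sum (fibreSize (g ∘ suc))  ≡⟨ sym (∑-distrib-+ first (fibreSize (g ∘ suc))) ⟩
  sum (fibreSize g)                      ∎
  where
  open ℕP.≤-Reasoning
  first : Fin _ → ℕ
  first i = indicator (g zero ≟ i)
  first-point : 1 ≤ sum first
  first-point = ℕP.≤-trans (indicator-refl (g zero ≟ g zero)) (term≤sum first (g zero))

ceilDiv-< : ∀ n a q → a + suc n ≤ suc n * q → ceilDiv a (suc n) < q
ceilDiv-< n a q a+N≤N*q = m<n*o⇒m/o<n (begin-strict
  a + n       <⟨ ℕP.+-monoʳ-< a (ℕP.n<1+n n) ⟩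
  a + suc n   ≤⟨ a+N≤N*q ⟩
  suc n * q   ≡⟨ ℕP.*-comm (suc n) q ⟩
  q * suc n   ∎)
  where open ℕP.≤-Reasoning

large-fibre : ∀ {n a} (g : Fin a → Fin (suc n)) → ∃ λ i → ceilDiv a (suc n) ≤ fibreSize g i
large-fibre {n} {a} g with FinP.any? (λ i → ceilDiv a (suc n) ℕP.≤? fibreSize g i)
... | yes large = large
... | no ¬large = contradiction (ceilDiv-< n a _ total) (ℕP.<-irrefl refl)
  where
  open ℕP.≤-Reasoning
  small : ∀ i → fibreSize g i < ceilDiv a (suc n)
  small i = ℕP.≰⇒> (λ le → ¬large (i , le))
  total : a + suc n ≤ suc n * ceilDiv a (suc n)
  total = begin
    a + suc n                  ≡⟨ ℕP.+-comm a (suc n) ⟩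
    suc n + a                  ≤⟨ ℕP.+-monoʳ-≤ (suc n) (fibres-cover a g) ⟩
    suc n + sum (fibreSize g)  ≤⟨ sum<-bound (fibreSize g) small ⟩
    suc n * ceilDiv a (suc n)  ∎

fibre-embedding : ∀ {N a} (g : Fin a → Fin N) (i : Fin N) m → m ≤ fibreSize g i →
  Σ (Fin m → Fin a) λ τ → Injective _≡_ _≡_ τ × (∀ j → g (τ j) ≡ i)
fibre-embedding g i zero _ = (λ ()) , (λ {}) , (λ ())
fibre-embedding {a = zero}  g i (suc m) ()
fibre-embedding {a = suc a} g i (suc m) enough with g zero ≟ i
... | yes g0≡i =
  let τ , τ-inj , τ∈fibre = fibre-embedding (g ∘ suc) i m (s≤s⁻¹ enough)
  in lift 1 τ , FinP.lift-injective τ τ-inj 1 , λ { zero → g0≡i ; (suc j) → τ∈fibre j }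
... | no _ =
  let τ , τ-inj , τ∈fibre = fibre-embedding (g ∘ suc) i (suc m) enough
  in suc ∘ τ , τ-inj ∘ FinP.suc-injective , τ∈fibre

pigeonhole : ∀ {n a} (g : Fin a → Fin (suc n)) → ∃ λ i →
  Σ (Fin (ceilDiv a (suc n)) → Fin a) λ τ → Injective _≡_ _≡_ τ × (∀ j → g (τ j) ≡ i)
pigeonhole g = let i , large = large-fibre g in i , fibre-embedding g i _ large

TriangleFree : ∀ {V K : Set} → (V → V → K) → Set
TriangleFree {V} {K} col = ∀ (x y z : V) → x ≢ y → x ≢ z → y ≢ z →
  ∀ {k : K} → col x y ≡ k → col x z ≡ k → col y z ≡ k → ⊥

MonoTriple : ∀ {n s} → EdgeColouring n s → Set
MonoTriple {s = s} c = ∃ λ (x : Fin s) → ∃ λ y → ∃ λ z →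
  x <ᶠ y × y <ᶠ z × c x y ≡ c x z × c x y ≡ c y z

triple : ∀ {A : Set} → A → A → A → Fin 3 → A
triple x y z zero             = x
triple x y z (suc zero)       = y
triple x y z (suc (suc zero)) = z

triple⇒clique : ∀ {n s} (c : EdgeColouring n s) → MonoTriple c → HasMonoClique c 3
triple⇒clique c (x , y , z , x<y , y<z , xy≡xz , xy≡yz) =
  c x y , triple x y z , increasing , monochromatic
  where
  increasing : ∀ i j → i <ᶠ j → triple x y z i <ᶠ triple x y z j
  increasing zero       (suc zero)       _ = x<y
  increasing zero       (suc (suc zero)) _ = ℕP.<-trans x<y y<z
  increasing (suc zero) (suc (suc zero)) _ = y<z
  increasing zero             zero             ()
  increasing (suc _)          zero             ()
  increasing (suc zero)       (suc zero)       (s≤s ())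
  increasing (suc (suc zero)) (suc zero)       (s≤s ())
  increasing (suc (suc zero)) (suc (suc zero)) (s≤s (s≤s ()))
  monochromatic : ∀ i j → i <ᶠ j → c (triple x y z i) (triple x y z j) ≡ c x y
  monochromatic zero       (suc zero)       _ = refl
  monochromatic zero       (suc (suc zero)) _ = sym xy≡xz
  monochromatic (suc zero) (suc (suc zero)) _ = sym xy≡yz
  monochromatic zero             zero             ()
  monochromatic (suc _)          zero             ()
  monochromatic (suc zero)       (suc zero)       (s≤s ())
  monochromatic (suc (suc zero)) (suc zero)       (s≤s ())
  monochromatic (suc (suc zero)) (suc (suc zero)) (s≤s (s≤s ()))

clique⇒triple : ∀ {n s} (c : EdgeColouring n s) → HasMonoClique c 3 → MonoTriple c
clique⇒triple c (k , f , increasing , monochromatic) =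
  f 0F , f 1F , f 2F , increasing 0F 1F (s≤s z≤n) , increasing 1F 2F (s≤s (s≤s z≤n)) ,
  trans (monochromatic 0F 1F (s≤s z≤n)) (sym (monochromatic 0F 2F (s≤s z≤n))) ,
  trans (monochromatic 0F 1F (s≤s z≤n)) (sym (monochromatic 1F 2F (s≤s (s≤s z≤n))))

mono-triangle? : ∀ {n s} (c : EdgeColouring n s) → Dec (HasMonoClique c 3)
mono-triangle? c = map′ (triple⇒clique c) (clique⇒triple c)
  (FinP.any? λ x → FinP.any? λ y → FinP.any? λ z →
    x FinP.<? y ×-dec y FinP.<? z ×-dec c x y ≟ c x z ×-dec c x y ≟ c y z)

symmetrise : ∀ {n s} → EdgeColouring n s → Fin s → Fin s → Fin n
symmetrise c x y with x FinP.<? y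
... | yes _ = c x y
... | no _  = c y x

symmetrise-< : ∀ {n s} (c : EdgeColouring n s) {x y} → x <ᶠ y → symmetrise c x y ≡ c x y
symmetrise-< c {x} {y} x<y with x FinP.<? y
... | yes _  = refl
... | no x≮y = contradiction x<y x≮y

symmetrise-> : ∀ {n s} (c : EdgeColouring n s) {x y} → y <ᶠ x → symmetrise c x y ≡ c y x
symmetrise-> c {x} {y} y<x with x FinP.<? y
... | yes x<y = contradiction y<x (FinP.<-asym x<y)
... | no _    = refl

symmetrise-comm : ∀ {n s} (c : EdgeColouring n s) {x y} → x ≢ y → symmetrise c x y ≡ symmetrise c y x
symmetrise-comm c {x} {y} x≢y with FinP.<-cmp x y
... | tri< x<y _ _ = trans (symmetrise-< c x<y) (sym (symmetrise-> c x<y))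
... | tri≈ _ x≡y _ = contradiction x≡y x≢y
... | tri> _ _ y<x = trans (symmetrise-> c y<x) (sym (symmetrise-< c y<x))

-- without a monochromatic K₃ the symmetrised colouring is triangle-free:
-- sort the three vertices and read off a monochromatic increasing triple
symmetrise-triangle-free : ∀ {n s} (c : EdgeColouring n s) →
  ¬ HasMonoClique c 3 → TriangleFree (symmetrise c)
symmetrise-triangle-free c no-mono x y z x≢y x≢z y≢z {k} xy xz yz =
  by-order (FinP.<-cmp x y) (FinP.<-cmp y z) (FinP.<-cmp x z)
  where
  swap : ∀ {u v} → u ≢ v → symmetrise c u v ≡ k → symmetrise c v u ≡ k
  swap u≢v uv = trans (symmetrise-comm c (λ v≡u → u≢v (sym v≡u))) uv
  edge : ∀ {p q} → p <ᶠ q → symmetrise c p q ≡ k → c p q ≡ k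
  edge p<q pq = trans (sym (symmetrise-< c p<q)) pq
  sorted : ∀ {u v w} → u <ᶠ v → v <ᶠ w →
    symmetrise c u v ≡ k → symmetrise c u w ≡ k → symmetrise c v w ≡ k → ⊥
  sorted u<v v<w uv uw vw = no-mono (triple⇒clique c (_ , _ , _ , u<v , v<w ,
    trans (edge u<v uv) (sym (edge (ℕP.<-trans u<v v<w) uw)) ,
    trans (edge u<v uv) (sym (edge v<w vw))))
  by-order : Tri (x <ᶠ y) (x ≡ y) (y <ᶠ x) → Tri (y <ᶠ z) (y ≡ z) (z <ᶠ y) →
    Tri (x <ᶠ z) (x ≡ z) (z <ᶠ x) → ⊥
  by-order (tri≈ _ x≡y _) _ _ = x≢y x≡y
  by-order _ (tri≈ _ y≡z _) _ = y≢z y≡z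
  by-order _ _ (tri≈ _ x≡z _) = x≢z x≡z
  by-order (tri< x<y _ _) (tri< y<z _ _) _ = sorted x<y y<z xy xz yz
  by-order (tri< x<y _ _) (tri> _ _ z<y) (tri< x<z _ _) =
    sorted x<z z<y xz xy (swap y≢z yz)
  by-order (tri< x<y _ _) (tri> _ _ z<y) (tri> _ _ z<x) =
    sorted z<x x<y (swap x≢z xz) (swap y≢z yz) xy
  by-order (tri> _ _ y<x) (tri< y<z _ _) (tri< x<z _ _) =
    sorted y<x x<z (swap x≢y xy) yz xz
  by-order (tri> _ _ y<x) (tri< y<z _ _) (tri> _ _ z<x) =
    sorted y<z z<x yz (swap x≢y xy) (swap x≢z xz)
  by-order (tri> _ _ y<x) (tri> _ _ z<y) _ =
    sorted z<y y<x (swap y≢z yz) (swap x≢z xz) (swap x≢y xy)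

triangle-free⇒¬arrows : ∀ {V K : Set} {n s} (col : V → V → K) → TriangleFree col →
  Fin s ↣ V → K ↣ Fin n → ¬ Arrows n s 3
triangle-free⇒¬arrows {V} col triangle-free vertices palette arrows
  with arrows (λ u v → Injection.to palette (col (Injection.to vertices u) (Injection.to vertices v)))
... | _ , f , increasing , monochromatic =
  triangle-free (v 0F) (v 1F) (v 2F)
    (distinct 0F 1F (s≤s z≤n)) (distinct 0F 2F (s≤s z≤n)) (distinct 1F 2F (s≤s (s≤s z≤n)))
    refl (same-colour 0F 2F (s≤s z≤n)) (same-colour 1F 2F (s≤s (s≤s z≤n)))
  where
  v : Fin 3 → V
  v i = Injection.to vertices (f i)
  distinct : ∀ i j → i <ᶠ j → v i ≢ v j
  distinct i j i<j vi≡vj = FinP.<⇒≢ (increasing i j i<j) (Injection.injective vertices vi≡vj)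
  same-colour : ∀ i j → i <ᶠ j → col (v i) (v j) ≡ col (v 0F) (v 1F)
  same-colour i j i<j = Injection.injective palette
    (trans (monochromatic i j i<j) (sym (monochromatic 0F 1F (s≤s z≤n))))

Neighbour : ∀ {V K : Set} → (V → V → K) → V → K → V → Set
Neighbour col p i y = y ≢ p × col p y ≡ i

neighbourhood-independent : ∀ {V K : Set} (col : V → V → K) → TriangleFree col →
  ∀ {p i y y'} → Neighbour col p i y → Neighbour col p i y' → y ≢ y' → col y y' ≢ i
neighbourhood-independent col triangle-free (y≢p , py) (y'≢p , py') y≢y' yy' =
  triangle-free _ _ _ (λ p≡y → y≢p (sym p≡y)) (λ p≡y' → y'≢p (sym p≡y')) y≢y' py py' yy'

arrows-mono : ∀ {k r s l} → r ≤ s → Arrows k r l → Arrows k s l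
arrows-mono {r = r} {s} r≤s arrows c
  with arrows (λ x y → c (inject≤ x r≤s) (inject≤ y r≤s))
... | colour , f , increasing , monochromatic =
  colour , (λ i → inject≤ (f i) r≤s) , increasing′ , monochromatic
  where
  increasing′ : ∀ i j → i <ᶠ j → inject≤ (f i) r≤s <ᶠ inject≤ (f j) r≤s
  increasing′ i j i<j rewrite FinP.toℕ-inject≤ (f i) r≤s | FinP.toℕ-inject≤ (f j) r≤s =
    increasing i j i<j

ramsey-exceeds : ∀ {k l r s} → IsRamsey k l r → ¬ Arrows k s l → s < r
ramsey-exceeds (_ , arrows , _) ¬arrows = ℕP.≰⇒> (λ r≤s → ¬arrows (arrows-mono r≤s arrows))

-- R_k(l) - 1 vertices do not arrow K_l (l ≥ 1): for R_k(l) = 1 the graph is empty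
below-ramsey : ∀ {k l r} → IsRamsey k (suc l) r → ¬ Arrows k (r ∸ 1) (suc l)
below-ramsey {r = zero} (() , _)
below-ramsey {r = suc zero} _ arrows with arrows (λ ())
... | _ , f , _ = FinP.¬Fin0 (f zero)
below-ramsey {r = suc (suc s)} (_ , _ , least) arrows =
  ℕP.<-irrefl refl (least (suc s) (s≤s z≤n) arrows)

clique-size≤ : ∀ {k s l} → Fin k → Arrows k s l → l ≤ s
clique-size≤ colour arrows with arrows (λ _ _ → colour)
... | _ , f , increasing , _ = FinP.injective⇒≤ injective
  where
  injective : ∀ {i j} → f i ≡ f j → i ≡ j
  injective {i} {j} fi≡fj with FinP.<-cmp i j
  ... | tri< i<j _ _ = contradiction fi≡fj (FinP.<⇒≢ (increasing i j i<j))
  ... | tri≈ _ i≡j _ = i≡j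
  ... | tri> _ _ j<i = contradiction (sym fi≡fj) (FinP.<⇒≢ (increasing j i j<i))

arrows-stable : ∀ {k s} → (∀ c → ¬ ¬ HasMonoClique c 3) → Arrows k s 3
arrows-stable ¬¬mono c = decidable-stable (mono-triangle? c) (¬¬mono c)

≢-on-first : ∀ {A B : Set} {x x' : A} {y y' : B} → (x , y) ≢ (x' , y') → y ≡ y' → x ≢ x'
≢-on-first d y≡y' x≡x' = d (cong₂ _,_ x≡x' y≡y')

≢-on-second : ∀ {A B : Set} {x x' : A} {y y' : B} → (x , y) ≢ (x' , y') → x ≡ x' → y ≢ y'
≢-on-second d x≡x' y≡y' = d (cong₂ _,_ x≡x' y≡y')

module Blowup
  {n a b m : ℕ}
  (c₁ : Fin a → Fin a → Fin (suc n))
  (c₁-comm : ∀ {x y} → x ≢ y → c₁ x y ≡ c₁ y x)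
  (c₁-triangle-free : TriangleFree c₁)
  (c₂ : Fin b → Fin b → Fin n)
  (c₂-triangle-free : TriangleFree c₂)
  (i : Fin (suc n))
  (T : Fin a → Set) (T? : ∀ y → Dec (T y))
  (T-independent : ∀ {y y'} → T y → T y' → y ≢ y' → c₁ y y' ≢ i)
  (τ : Fin m → Fin a) (τ-injective : Injective _≡_ _≡_ τ) (τ∈T : ∀ j → T (τ j))
  where

  private variable
    x x' x₁ x₂ x₃ y y' y₁ y₂ y₃ : Fin a
    j j' j₁ j₂ j₃ : Fin m
    k k' k₁ k₂ k₃ : Fin b
    c : Fin (suc n)

  Colour : Set
  Colour = Fin (suc n) ⊎ Fin (suc n)

  σ : Fin a → Fin a → Fin (suc n)
  σ y y' with y ≟ y'
  ... | yes _ = i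
  ... | no _  = c₁ y y'

  σ-diagonal : y ≡ y' → σ y y' ≡ c → i ≡ c
  σ-diagonal {y} {y'} y≡y' σ≡c with y ≟ y'
  ... | yes _    = σ≡c
  ... | no y≢y'  = contradiction y≡y' y≢y'

  σ-off-diagonal : y ≢ y' → σ y y' ≡ c → c₁ y y' ≡ c
  σ-off-diagonal {y} {y'} y≢y' σ≡c with y ≟ y'
  ... | yes y≡y' = contradiction y≡y' y≢y'
  ... | no _     = σ≡c

  σ-comm : ∀ y y' → σ y y' ≡ σ y' y
  σ-comm y y' with y ≟ y' | y' ≟ y
  ... | yes _    | yes _    = refl
  ... | no y≢y'  | no _     = c₁-comm y≢y'
  ... | yes y≡y' | no y'≢y  = contradiction (sym y≡y') y'≢y
  ... | no y≢y'  | yes y'≡y = contradiction (sym y'≡y) y≢y'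

  Recoloured : Fin a → Fin a → Fin a → Fin a → Set
  Recoloured x y x' y' = x ≢ x' × c₁ x x' ≡ i × T y × T y'

  InSecondPalette : Fin a → Fin a → Fin a → Fin a → Set
  InSecondPalette x y x' y' = x ≡ x' ⊎ Recoloured x y x' y'

  inSecondPalette? : ∀ x y x' y' → Dec (InSecondPalette x y x' y')
  inSecondPalette? x y x' y' =
    x ≟ x' ⊎-dec (¬? (x ≟ x') ×-dec c₁ x x' ≟ i ×-dec T? y ×-dec T? y')

  product-colour : Fin a → Fin a → Fin a → Fin a → Colour
  product-colour x y x' y' with inSecondPalette? x y x' y'
  ... | yes _ = inj₂ (σ y y')
  ... | no _  = inj₁ (c₁ x x')

  SecondColour : Fin a → Fin a → Fin a → Fin a → Fin (suc n) → Set
  SecondColour x y x' y' c = InSecondPalette x y x' y' × σ y y' ≡ c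

  product-first : product-colour x y x' y' ≡ inj₁ c →
    x ≢ x' × ¬ Recoloured x y x' y' × c₁ x x' ≡ c
  product-first {x} {y} {x'} {y'} colour≡ with inSecondPalette? x y x' y'
  product-first () | yes _
  product-first refl | no ¬second = ¬second ∘ inj₁ , ¬second ∘ inj₂ , refl

  product-second : product-colour x y x' y' ≡ inj₂ c → SecondColour x y x' y' c
  product-second {x} {y} {x'} {y'} colour≡ with inSecondPalette? x y x' y'
  product-second refl | yes second = second , refl
  product-second () | no _

  second-swap : SecondColour x y x' y' c → SecondColour x' y' x y c
  second-swap {y = y} {y' = y'} (inj₁ x≡x' , σ≡c) = inj₁ (sym x≡x') , trans (σ-comm y' y) σ≡c
  second-swap {y = y} {y' = y'} (inj₂ (x≢x' , c₁≡i , Ty , Ty') , σ≡c) =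
    inj₂ (x≢x' ∘ sym , trans (sym (c₁-comm x≢x')) c₁≡i , Ty' , Ty) , trans (σ-comm y' y) σ≡c

  across-columns : x ≢ x' → InSecondPalette x y x' y' → c₁ x x' ≡ i × T y
  across-columns x≢x' (inj₁ x≡x')                 = contradiction x≡x' x≢x'
  across-columns _    (inj₂ (_ , c₁≡i , Ty , _)) = c₁≡i , Ty

  within-column : ¬ T y' → InSecondPalette x y x' y' → x ≡ x'
  within-column ¬Ty' (inj₁ x≡x')              = x≡x'
  within-column ¬Ty' (inj₂ (_ , _ , _ , Ty')) = contradiction Ty' ¬Ty'

  -- second-palette triangle inside one row: its columns form an i-coloured c₁-triangle
  one-row-triangle : (x₁ , y₁) ≢ (x₂ , y₂) → (x₁ , y₁) ≢ (x₃ , y₃) → (x₂ , y₂) ≢ (x₃ , y₃) →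
    y₁ ≡ y₂ → y₁ ≡ y₃ → InSecondPalette x₁ y₁ x₂ y₂ → InSecondPalette x₁ y₁ x₃ y₃ →
    InSecondPalette x₂ y₂ x₃ y₃ → ⊥
  one-row-triangle d₁₂ d₁₃ d₂₃ refl refl e₁₂ e₁₃ e₂₃ =
    c₁-triangle-free _ _ _ (≢-on-first d₁₂ refl) (≢-on-first d₁₃ refl) (≢-on-first d₂₃ refl)
      (proj₁ (across-columns (≢-on-first d₁₂ refl) e₁₂))
      (proj₁ (across-columns (≢-on-first d₁₃ refl) e₁₃))
      (proj₁ (across-columns (≢-on-first d₂₃ refl) e₂₃))

  -- second-palette triangle with exactly two vertices in one row: the common
  -- colour is i, so the third row lies outside T, forcing all three into one column
  two-row-triangle : (x₁ , y₁) ≢ (x₂ , y₂) → y₁ ≡ y₂ → y₁ ≢ y₃ →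
    SecondColour x₁ y₁ x₂ y₂ c → SecondColour x₁ y₁ x₃ y₃ c → SecondColour x₂ y₂ x₃ y₃ c → ⊥
  two-row-triangle {x₁} {y₁} {x₂} {y₂} {y₃} d₁₂ y₁≡y₂ y₁≢y₃ (e₁₂ , σ₁₂) (e₁₃ , σ₁₃) (e₂₃ , _) =
    d₁₂ (cong₂ _,_ (trans (within-column ¬Ty₃ e₁₃) (sym (within-column ¬Ty₃ e₂₃))) y₁≡y₂)
    where
    Ty₁ : T y₁
    Ty₁ = proj₂ (across-columns (≢-on-first d₁₂ y₁≡y₂) e₁₂)
    ¬Ty₃ : ¬ T y₃
    ¬Ty₃ Ty₃ = T-independent Ty₁ Ty₃ y₁≢y₃
      (trans (σ-off-diagonal y₁≢y₃ σ₁₃) (sym (σ-diagonal y₁≡y₂ σ₁₂)))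

  second-palette-triangle : (x₁ , y₁) ≢ (x₂ , y₂) → (x₁ , y₁) ≢ (x₃ , y₃) → (x₂ , y₂) ≢ (x₃ , y₃) →
    SecondColour x₁ y₁ x₂ y₂ c → SecondColour x₁ y₁ x₃ y₃ c → SecondColour x₂ y₂ x₃ y₃ c → ⊥
  second-palette-triangle {y₁ = y₁} {y₂ = y₂} {y₃ = y₃} d₁₂ d₁₃ d₂₃ e₁₂ e₁₃ e₂₃ =
    by-rows (y₁ ≟ y₂) (y₁ ≟ y₃) (y₂ ≟ y₃)
    where
    by-rows : Dec (y₁ ≡ y₂) → Dec (y₁ ≡ y₃) → Dec (y₂ ≡ y₃) → ⊥
    by-rows (yes y₁≡y₂) (yes y₁≡y₃) _ =
      one-row-triangle d₁₂ d₁₃ d₂₃ y₁≡y₂ y₁≡y₃ (proj₁ e₁₂) (proj₁ e₁₃) (proj₁ e₂₃)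
    by-rows (yes y₁≡y₂) (no y₁≢y₃) _ = two-row-triangle d₁₂ y₁≡y₂ y₁≢y₃ e₁₂ e₁₃ e₂₃
    by-rows (no y₁≢y₂) (yes y₁≡y₃) _ =
      two-row-triangle d₁₃ y₁≡y₃ y₁≢y₂ e₁₃ e₁₂ (second-swap e₂₃)
    by-rows (no y₁≢y₂) (no _) (yes y₂≡y₃) =
      two-row-triangle d₂₃ y₂≡y₃ (y₁≢y₂ ∘ sym) e₂₃ (second-swap e₁₂) (second-swap e₁₃)
    by-rows (no y₁≢y₂) (no y₁≢y₃) (no y₂≢y₃) =
      c₁-triangle-free y₁ y₂ y₃ y₁≢y₂ y₁≢y₃ y₂≢y₃ (σ-off-diagonal y₁≢y₂ (proj₂ e₁₂))
        (σ-off-diagonal y₁≢y₃ (proj₂ e₁₃)) (σ-off-diagonal y₂≢y₃ (proj₂ e₂₃))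

  no-product-triangle : (x₁ , y₁) ≢ (x₂ , y₂) → (x₁ , y₁) ≢ (x₃ , y₃) → (x₂ , y₂) ≢ (x₃ , y₃) →
    ∀ {colour} → product-colour x₁ y₁ x₂ y₂ ≡ colour → product-colour x₁ y₁ x₃ y₃ ≡ colour →
    product-colour x₂ y₂ x₃ y₃ ≡ colour → ⊥
  no-product-triangle d₁₂ d₁₃ d₂₃ {inj₁ _} e₁₂ e₁₃ e₂₃
    with product-first e₁₂ | product-first e₁₃ | product-first e₂₃
  ... | x₁≢x₂ , _ , c₁₂ | x₁≢x₃ , _ , c₁₃ | x₂≢x₃ , _ , c₂₃ =
    c₁-triangle-free _ _ _ x₁≢x₂ x₁≢x₃ x₂≢x₃ c₁₂ c₁₃ c₂₃
  no-product-triangle d₁₂ d₁₃ d₂₃ {inj₂ _} e₁₂ e₁₃ e₂₃ =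
    second-palette-triangle d₁₂ d₁₃ d₂₃ (product-second e₁₂) (product-second e₁₃) (product-second e₂₃)

  -- Block vertices (j , k) ∈ Fin m × Fin b: m copies of the colouring c₂, the
  -- j-th copy attached to the vertex τ j of T.
  block-colour : Fin m → Fin b → Fin m → Fin b → Colour
  block-colour j k j' k' with j ≟ j'
  ... | yes _ = inj₁ (punchIn i (c₂ k k'))
  ... | no _  = inj₂ (c₁ (τ j) (τ j'))

  block-first : block-colour j k j' k' ≡ inj₁ c → j ≡ j' × punchIn i (c₂ k k') ≡ c
  block-first {j} {k} {j'} {k'} colour≡ with j ≟ j'
  block-first refl | yes j≡j' = j≡j' , refl
  block-first ()   | no _

  block-second : block-colour j k j' k' ≡ inj₂ c → j ≢ j' × c₁ (τ j) (τ j') ≡ c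
  block-second {j} {k} {j'} {k'} colour≡ with j ≟ j'
  block-second ()   | yes _
  block-second refl | no j≢j' = j≢j' , refl

  link-colour : Fin a → Fin m → Colour
  link-colour y j with T? y
  ... | yes _ = inj₁ i
  ... | no _  = inj₂ (c₁ (τ j) y)

  link-first : link-colour y j ≡ inj₁ c → T y × i ≡ c
  link-first {y} colour≡ with T? y
  link-first refl | yes Ty = Ty , refl
  link-first ()   | no _

  link-second : link-colour y j ≡ inj₂ c → ¬ T y × c₁ (τ j) y ≡ c
  link-second {y} colour≡ with T? y
  link-second ()   | yes _
  link-second refl | no ¬Ty = ¬Ty , refl

  τ≢ : ¬ T y → τ j ≢ y
  τ≢ {j = j} ¬Ty τj≡y = ¬Ty (subst T τj≡y (τ∈T j))

  no-product-product-block : (x₁ , y₁) ≢ (x₂ , y₂) → ∀ {colour} →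
    product-colour x₁ y₁ x₂ y₂ ≡ colour → link-colour y₁ j ≡ colour → link-colour y₂ j ≡ colour → ⊥
  no-product-product-block d₁₂ {inj₁ _} e₁₂ l₁ l₂
    with product-first e₁₂ | link-first l₁ | link-first l₂
  ... | x₁≢x₂ , ¬recoloured , c₁₂ | Ty₁ , i≡c | Ty₂ , _ =
    ¬recoloured (x₁≢x₂ , trans c₁₂ (sym i≡c) , Ty₁ , Ty₂)
  no-product-product-block {y₁ = y₁} {y₂ = y₂} {j = j} d₁₂ {inj₂ _} e₁₂ l₁ l₂
    with product-second e₁₂ | link-second l₁ | link-second l₂
  ... | second , σ₁₂ | ¬Ty₁ , τy₁ | ¬Ty₂ , τy₂ =
    c₁-triangle-free (τ j) _ _ (τ≢ ¬Ty₁) (τ≢ ¬Ty₂) y₁≢y₂ τy₁ τy₂ (σ-off-diagonal y₁≢y₂ σ₁₂)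
    where
    -- y₂ ∉ T, so the edge is vertical and its rows differ
    y₁≢y₂ : y₁ ≢ y₂
    y₁≢y₂ = ≢-on-second d₁₂ (within-column ¬Ty₂ second)

  no-product-block-block : ∀ {colour} → link-colour y j₁ ≡ colour → link-colour y j₂ ≡ colour →
    block-colour j₁ k₁ j₂ k₂ ≡ colour → ⊥
  no-product-block-block {k₁ = k₁} {k₂ = k₂} {colour = inj₁ _} l₁ _ b₁₂
    with link-first l₁ | block-first b₁₂
  ... | _ , i≡c | _ , punchIn≡c = FinP.punchInᵢ≢i i (c₂ k₁ k₂) (trans punchIn≡c (sym i≡c))
  no-product-block-block {colour = inj₂ _} l₁ l₂ b₁₂
    with link-second l₁ | link-second l₂ | block-second b₁₂
  ... | ¬Ty , τ₁y | _ , τ₂y | j₁≢j₂ , τ₁τ₂ =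
    c₁-triangle-free _ _ _ (j₁≢j₂ ∘ τ-injective) (τ≢ ¬Ty) (τ≢ ¬Ty) τ₁τ₂ τ₁y τ₂y

  no-block-triangle : (j₁ , k₁) ≢ (j₂ , k₂) → (j₁ , k₁) ≢ (j₃ , k₃) → (j₂ , k₂) ≢ (j₃ , k₃) →
    ∀ {colour} → block-colour j₁ k₁ j₂ k₂ ≡ colour → block-colour j₁ k₁ j₃ k₃ ≡ colour →
    block-colour j₂ k₂ j₃ k₃ ≡ colour → ⊥
  no-block-triangle d₁₂ d₁₃ d₂₃ {inj₁ _} b₁₂ b₁₃ b₂₃
    with block-first b₁₂ | block-first b₁₃ | block-first b₂₃
  ... | j₁≡j₂ , p₁₂ | j₁≡j₃ , p₁₃ | j₂≡j₃ , p₂₃ =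
    c₂-triangle-free _ _ _ (≢-on-second d₁₂ j₁≡j₂) (≢-on-second d₁₃ j₁≡j₃) (≢-on-second d₂₃ j₂≡j₃)
      refl (FinP.punchIn-injective i _ _ (trans p₁₃ (sym p₁₂)))
      (FinP.punchIn-injective i _ _ (trans p₂₃ (sym p₁₂)))
  no-block-triangle d₁₂ d₁₃ d₂₃ {inj₂ _} b₁₂ b₁₃ b₂₃
    with block-second b₁₂ | block-second b₁₃ | block-second b₂₃
  ... | j₁≢j₂ , τ₁₂ | j₁≢j₃ , τ₁₃ | j₂≢j₃ , τ₂₃ =
    c₁-triangle-free _ _ _ (j₁≢j₂ ∘ τ-injective) (j₁≢j₃ ∘ τ-injective) (j₂≢j₃ ∘ τ-injective)
      τ₁₂ τ₁₃ τ₂₃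

  Vertex : Set
  Vertex = (Fin a × Fin a) ⊎ (Fin m × Fin b)

  colour : Vertex → Vertex → Colour
  colour (inj₁ (x , y)) (inj₁ (x' , y')) = product-colour x y x' y'
  colour (inj₁ (_ , y)) (inj₂ (j , _))   = link-colour y j
  colour (inj₂ (j , _)) (inj₁ (_ , y))   = link-colour y j
  colour (inj₂ (j , k)) (inj₂ (j' , k')) = block-colour j k j' k'

  colour-triangle-free : TriangleFree colour
  colour-triangle-free (inj₁ _) (inj₁ _) (inj₁ _) d₁₂ d₁₃ d₂₃ =
    no-product-triangle (d₁₂ ∘ cong inj₁) (d₁₃ ∘ cong inj₁) (d₂₃ ∘ cong inj₁)
  colour-triangle-free (inj₁ _) (inj₁ _) (inj₂ _) d₁₂ _ _ e₁₂ e₁₃ e₂₃ =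
    no-product-product-block (d₁₂ ∘ cong inj₁) e₁₂ e₁₃ e₂₃
  colour-triangle-free (inj₁ _) (inj₂ _) (inj₁ _) _ d₁₃ _ e₁₂ e₁₃ e₂₃ =
    no-product-product-block (d₁₃ ∘ cong inj₁) e₁₃ e₁₂ e₂₃
  colour-triangle-free (inj₂ _) (inj₁ _) (inj₁ _) _ _ d₂₃ e₁₂ e₁₃ e₂₃ =
    no-product-product-block (d₂₃ ∘ cong inj₁) e₂₃ e₁₂ e₁₃
  colour-triangle-free (inj₁ _) (inj₂ _) (inj₂ _) _ _ _ e₁₂ e₁₃ e₂₃ =
    no-product-block-block e₁₂ e₁₃ e₂₃
  colour-triangle-free (inj₂ _) (inj₁ _) (inj₂ _) _ _ _ e₁₂ e₁₃ e₂₃ =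
    no-product-block-block e₁₂ e₂₃ e₁₃
  colour-triangle-free (inj₂ _) (inj₂ _) (inj₁ _) _ _ _ e₁₂ e₁₃ e₂₃ =
    no-product-block-block e₁₃ e₂₃ e₁₂
  colour-triangle-free (inj₂ _) (inj₂ _) (inj₂ _) d₁₂ d₁₃ d₂₃ =
    no-block-triangle (d₁₂ ∘ cong inj₂) (d₁₃ ∘ cong inj₂) (d₂₃ ∘ cong inj₂)

  no-arrows : ¬ Arrows (2 * suc n) (a * a + m * b) 3
  no-arrows = subst (λ colours → ¬ Arrows colours (a * a + m * b) 3)
    (cong (suc n +_) (sym (ℕP.+-identityʳ (suc n))))
    (triangle-free⇒¬arrows colour colour-triangle-free
      (↔⇒↣ (↔-trans FinP.+↔⊎ (FinP.*↔× ⊎-↔ FinP.*↔×)))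
      (↔⇒↣ (↔-sym FinP.+↔⊎)))

-- T is a largest colour class i of the neighbourhood of vertex 0 in c₁.
blowup : ∀ {n a b} (c₁ : EdgeColouring (suc n) (suc a)) (c₂ : EdgeColouring n b) →
  ¬ HasMonoClique c₁ 3 → ¬ HasMonoClique c₂ 3 →
  ¬ Arrows (2 * suc n) (suc a * suc a + ceilDiv a (suc n) * b) 3
blowup {n} {a} {b} c₁ c₂ ¬mono₁ ¬mono₂ =
  Blowup.no-arrows s₁ (symmetrise-comm c₁) s₁-triangle-free s₂
    (symmetrise-triangle-free c₂ ¬mono₂) i T T? T-independent τ τ-injective τ∈T
  where
  s₁ : Fin (suc a) → Fin (suc a) → Fin (suc n)
  s₁ = symmetrise c₁
  s₂ : Fin b → Fin b → Fin n
  s₂ = symmetrise c₂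
  s₁-triangle-free : TriangleFree s₁
  s₁-triangle-free = symmetrise-triangle-free c₁ ¬mono₁
  pigeon : ∃ λ i → Σ (Fin (ceilDiv a (suc n)) → Fin a) λ τ₀ →
    Injective _≡_ _≡_ τ₀ × (∀ j → s₁ zero (suc (τ₀ j)) ≡ i)
  pigeon = pigeonhole (λ y → s₁ zero (suc y))
  i : Fin (suc n)
  i = proj₁ pigeon
  T : Fin (suc a) → Set
  T = Neighbour s₁ zero i
  T? : ∀ y → Dec (T y)
  T? y = ¬? (y ≟ zero) ×-dec s₁ zero y ≟ i
  T-independent : ∀ {y y'} → T y → T y' → y ≢ y' → s₁ y y' ≢ i
  T-independent = neighbourhood-independent s₁ s₁-triangle-free
  τ : Fin (ceilDiv a (suc n)) → Fin (suc a)
  τ = suc ∘ proj₁ (proj₂ pigeon)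
  τ-injective : ∀ {j j'} → τ j ≡ τ j' → j ≡ j'
  τ-injective = proj₁ (proj₂ (proj₂ pigeon)) ∘ FinP.suc-injective
  τ∈T : ∀ j → T (τ j)
  τ∈T j = (λ ()) , proj₂ (proj₂ (proj₂ pigeon)) j

mainTheorem2 : (n : ℕ) → .{{_ : NonZero n}} → 2 ≤ n →
    (r₂ₙ rₙ rₙ₋₁ : ℕ) →
    IsRamsey (2 * n) 3 r₂ₙ → IsRamsey n 3 rₙ → IsRamsey (n ∸ 1) 3 rₙ₋₁ →
    (rₙ ∸ 1) * (rₙ ∸ 1) + ceilDiv (rₙ ∸ 2) n * (rₙ₋₁ ∸ 1) + 1 ≤ r₂ₙ
mainTheorem2 (suc n) _ r₂ₙ (suc (suc a)) rₙ₋₁ R₂ₙ Rₙ Rₙ₋₁ =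
  subst (_≤ r₂ₙ) (ℕP.+-comm 1 _) (ramsey-exceeds R₂ₙ no-arrows)
  where
  -- a 2(n+1)-colouring of this size with a monochromatic triangle everywhere would,
  -- through blowup, leave none of K_{rₙ - 1} and K_{rₙ₋₁ - 1} without one
  no-arrows : ¬ Arrows (2 * suc n) (suc a * suc a + ceilDiv a (suc n) * (rₙ₋₁ ∸ 1)) 3
  no-arrows arrows = below-ramsey Rₙ (arrows-stable λ c₁ ¬mono₁ →
    below-ramsey Rₙ₋₁ (arrows-stable λ c₂ ¬mono₂ → blowup c₁ c₂ ¬mono₁ ¬mono₂ arrows))
-- R_n(3) ≥ 2 (in fact ≥ 3), since K₃ needs three vertices
mainTheorem2 (suc n) _ _ zero _ _ (() , _) _
mainTheorem2 (suc n) _ _ (suc zero) _ _ (_ , arrowsₙ , _) _ with clique-size≤ zero arrowsₙ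
... | s≤s ()
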